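{- Let $G$ be a finite simple graph, let $C$ be a longest cycle in $G$ and put $c=|C|$. Let $Q$ be a path in $G\backslash C$, and let $P_i$ be a $(v_i,w_i)$-path in $G\backslash C$ for $i=0,\dots,q$, where $P_0,\dots,P_q$ are pairwise vertex-disjoint and have only the vertices $v_0,\dots,v_q$ in common with $Q$ (so $V(P_i)\cap V(Q)=\{v_i\}$; a path $P_i$ may consist of the single vertex $v_i=w_i$). For $i=0,\dots,q$ let $Z_i=N(w_i)\cap V(C)$. Then $$c\geq \sum_{i=0}^{q}|Z_i| + \Big|\bigcup_{i=0}^{q} Z_i\Big|.$$
   Context: Graphs are finite, undirected, without loops or multiple edges. $G\backslash C$ denotes the subgraph induced by $V(G)\setminus V(C)$. The length of a cycle is its number of edges; a single vertex counts as a cycle of length $1$ and a single edge as a cycle of length $2$. $N(v)$ is the set of neighbours of $v$. A $(x,y)$-path is a path with endvertices $x$ and $y$. -}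

module Defs where

open import Data.Nat using (ℕ; suc; _≤_)
open import Data.Bool using (Bool; true; false; _∧_)
open import Data.Fin using (Fin; _≟_)
open import Data.Fin.Subset using (Subset; ⋃; ∣_∣)
open import Data.List using (List; []; _∷_; length)
open import Data.Nat.ListAction using (sum)
import Data.List as L
open import Data.List.Relation.Unary.Unique.Propositional using (Unique)
open import Data.List.Relation.Unary.Linked using (Linked)
import Data.List.Membership.DecPropositional as DecMem
open import Data.Vec using (tabulate)
open import Data.Product using (_×_)
open import Data.Empty using (⊥)
open import Relation.Binary.PropositionalEquality using (_≡_)
open import Relation.Nullary.Decidable using (⌊_⌋)

record Graph (n : ℕ) : Set where
  field
    adj    : Fin n → Fin n → Bool
    sym    : ∀ u v → adj u v ≡ adj v u
    irrefl : ∀ v → adj v v ≡ false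

module _ {n : ℕ} (G : Graph n) where
  open Graph G
  open DecMem (_≟_ {n}) using (_∈?_)

  Adj : Fin n → Fin n → Set
  Adj u v = adj u v ≡ true

  lastOf : Fin n → List (Fin n) → Fin n
  lastOf x []       = x
  lastOf x (y ∷ ys) = lastOf y ys

  -- A single vertex is a cycle of length 1, an edge a cycle of length 2;
  -- with ≥ 3 vertices the last vertex must be adjacent to the first.
  IsCycle : List (Fin n) → Set
  IsCycle []       = ⊥
  IsCycle (x ∷ xs) = Unique (x ∷ xs) × Linked Adj (x ∷ xs)
                     × (2 ≤ length xs → Adj (lastOf x xs) x)

  IsPath : List (Fin n) → Set
  IsPath []       = ⊥
  IsPath (x ∷ xs) = Unique (x ∷ xs) × Linked Adj (x ∷ xs)

  IsPathBetween : Fin n → Fin n → List (Fin n) → Set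
  IsPathBetween v w []       = ⊥
  IsPathBetween v w (x ∷ xs) = x ≡ v × lastOf x xs ≡ w × IsPath (x ∷ xs)

  NC : List (Fin n) → Fin n → Subset n
  NC C w = tabulate (λ u → adj w u ∧ ⌊ u ∈? C ⌋)

ΣFin : (m : ℕ) → (Fin m → ℕ) → ℕ
ΣFin m f = sum (L.tabulate f)

⋃Fin : {n : ℕ} (m : ℕ) → (Fin m → Subset n) → Subset n
⋃Fin m Z = ⋃ (L.tabulate Z)

-- Write r i for the position of v i on Q. Going back along P i, along Q to v j and out along P j
-- gives a (w i, w j)-path in G ∖ C with more than |r i − r j| vertices. So if w i is adjacent to
-- x ∈ C and w j to y ∈ C, either arc of C from x to y closes up with it into a cycle, and the
-- maximality of C bounds the number of vertices of the arc by c − 1 − |r i − r j|.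
--
-- Weight each vertex u of C by g u = #{i : u ∈ Z i} + [u ∈ ⋃ Z], so that the right-hand side is
-- Σ g, and let lo u and hi u be the least and greatest r i over the w i adjacent to u. The r i are
-- distinct, hence g u ≤ hi u − lo u + 2. The arc bound says that weighted vertices u, u′ at
-- distance δ along C satisfy δ ≥ 2 + max (hi u − lo u′) (hi u′ − lo u), and the maximum is at
-- least the mean of hi u − lo u and hi u′ − lo u′. Summing over consecutive weighted vertices
-- around C gives c ≥ Σ (2 + hi u − lo u) ≥ Σ g.

module Submission where

open import Defs
open import Data.Nat using (ℕ; zero; suc; _+_; _*_; _∸_; _≤_; _<_; s≤s; s≤s⁻¹; z≤n; z<s)
open import Data.Nat.Properties renaming (_≟_ to _≟ℕ_)
open import Data.Nat.ListAction using (sum)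
open import Data.Nat.Tactic.RingSolver using (solve; solve-∀)
open import Algebra.Properties.CommutativeSemigroup +-commutativeSemigroup
  using (interchange; x∙yz≈y∙xz)
open import Data.Bool using (Bool; true; false; _∧_; _∨_; not; if_then_else_)
open import Data.Bool.Properties using (∧-identityʳ)
open import Data.Fin using (Fin; zero; suc; _≟_)
import Data.Fin.Properties as Fin
open import Data.Fin.Subset using (Subset; ⋃; ∣_∣)
open import Data.Vec as Vec using (lookup)
import Data.Vec.Properties as Vecₚ
open import Data.List as List using (List; []; _∷_; length; _++_; map; [_]; reverse)
open import Data.List.Properties
  using (length-++; ++-assoc; ∷-injective; ++-identityʳ; unfold-reverse; length-reverse)
open import Data.List.Membership.Propositional using (_∈_; _∉_)
open import Data.List.Membership.Propositional.Properties
  using (∈-++⁺ʳ; ∈-++⁻; ∈-∃++; ∈-allFin; ∈-tabulate⁻)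
open import Data.List.Extrema ≤-totalOrder using (argmin; argmax; f[argmin]≤f[xs]; f[xs]≤f[argmax])
open import Data.List.Relation.Unary.All as All using (All)
import Data.List.Relation.Unary.All.Properties as All
open import Data.List.Relation.Unary.Any using (here; there)
import Data.List.Relation.Unary.Any.Properties as Any
open import Data.List.Relation.Unary.Unique.Propositional using (Unique)
open import Data.List.Relation.Unary.Unique.Propositional.Properties using (Unique[x∷xs]⇒x∉xs)
  renaming (++⁺ to Unique-++⁺)
open import Data.List.Relation.Unary.Linked using (Linked)
open import Data.List.Relation.Binary.Disjoint.Propositional using (Disjoint)
open import Data.List.Relation.Binary.Subset.Propositional using (_⊆_)
open import Data.List.Relation.Binary.Subset.Propositional.Properties
  using (⊆-trans; ⊆-reflexive; ⊆-reflexive-↭; xs⊆xs++ys; xs⊆ys++xs; xs⊆x∷xs; All-resp-⊇)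
import Data.List.Relation.Binary.Disjoint.Propositional.Properties as Disjoint
open import Data.List.Relation.Binary.Permutation.Propositional using (_↭_)
open import Data.List.Relation.Binary.Permutation.Propositional.Properties using (++-comm)
open import Data.Product using (_×_; _,_; proj₁; proj₂; ∃; ∃₂)
open import Data.Sum using (inj₁; inj₂)
open import Relation.Binary.PropositionalEquality hiding ([_])
open import Relation.Nullary using (yes; no; contradiction)
open import Relation.Binary.Definitions using (tri<; tri≈; tri>)
open import Relation.Nullary.Decidable using (⌊_⌋)
open import Function using (_∘_)

nth : ∀ {A : Set} → A → List A → ℕ → A
nth d []       p       = d
nth d (x ∷ xs) zero    = x
nth d (x ∷ xs) (suc p) = nth d xs p

sumBelow : ℕ → (ℕ → ℕ) → ℕ
sumBelow zero    f = 0
sumBelow (suc t) f = sumBelow t f + f t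

sumBelow-suc : ∀ t f → sumBelow (suc t) f ≡ f 0 + sumBelow t (λ p → f (suc p))
sumBelow-suc zero    f = +-comm 0 (f 0)
sumBelow-suc (suc t) f = trans (cong (_+ f (suc t)) (sumBelow-suc t f)) (+-assoc (f 0) _ _)

sum-map≡sumBelow-nth : ∀ {A : Set} (f : A → ℕ) d xs →
                       sum (map f xs) ≡ sumBelow (length xs) (λ p → f (nth d xs p))
sum-map≡sumBelow-nth f d []       = refl
sum-map≡sumBelow-nth f d (x ∷ xs) =
  trans (cong (f x +_) (sum-map≡sumBelow-nth f d xs))
        (sym (sumBelow-suc (length xs) (λ p → f (nth d (x ∷ xs) p))))

ΣFin-cong : ∀ m {f g : Fin m → ℕ} → (∀ i → f i ≡ g i) → ΣFin m f ≡ ΣFin m g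
ΣFin-cong zero    eq = refl
ΣFin-cong (suc m) eq = cong₂ _+_ (eq zero) (ΣFin-cong m (λ i → eq (suc i)))

ΣFin-zero : ∀ m {f : Fin m → ℕ} → (∀ i → f i ≡ 0) → ΣFin m f ≡ 0
ΣFin-zero zero    eq = refl
ΣFin-zero (suc m) eq rewrite eq zero = ΣFin-zero m (λ i → eq (suc i))

ΣFin-+ : ∀ m (f g : Fin m → ℕ) → ΣFin m (λ i → f i + g i) ≡ ΣFin m f + ΣFin m g
ΣFin-+ zero    f g = refl
ΣFin-+ (suc m) f g rewrite ΣFin-+ m (λ i → f (suc i)) (λ i → g (suc i)) =
  interchange (f zero) (g zero) (ΣFin m (λ i → f (suc i))) (ΣFin m (λ i → g (suc i)))

ΣFin-swap : ∀ a b (f : Fin a → Fin b → ℕ) →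
            ΣFin a (λ i → ΣFin b (f i)) ≡ ΣFin b (λ j → ΣFin a (λ i → f i j))
ΣFin-swap zero    b f = sym (ΣFin-zero b (λ _ → refl))
ΣFin-swap (suc a) b f =
  trans (cong (ΣFin b (f zero) +_) (ΣFin-swap a b (λ i → f (suc i))))
        (sym (ΣFin-+ b (f zero) (λ j → ΣFin a (λ i → f (suc i) j))))

zeroAt : ∀ {m} → Fin m → (Fin m → ℕ) → Fin m → ℕ
zeroAt x f i = if ⌊ i ≟ x ⌋ then 0 else f i

zeroAt≤ : ∀ {m} (x : Fin m) f i → zeroAt x f i ≤ f i
zeroAt≤ x f i with i ≟ x
... | yes _ = z≤n
... | no  _ = ≤-refl

ΣFin-split : ∀ m (x : Fin m) (f : Fin m → ℕ) → ΣFin m f ≡ f x + ΣFin m (zeroAt x f)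
ΣFin-split (suc m) zero    f = refl
ΣFin-split (suc m) (suc x) f =
  begin
    f zero + ΣFin m (f ∘ suc)
      ≡⟨ cong (f zero +_) (ΣFin-split m x (f ∘ suc)) ⟩
    f zero + (f (suc x) + ΣFin m (zeroAt x (f ∘ suc)))
      ≡⟨ x∙yz≈y∙xz (f zero) (f (suc x)) _ ⟩
    f (suc x) + (f zero + ΣFin m (zeroAt x (f ∘ suc)))
      ≡⟨ cong (λ s → f (suc x) + (f zero + s)) (ΣFin-cong m zeroAt-suc) ⟩
    f (suc x) + ΣFin (suc m) (zeroAt (suc x) f)
      ∎
  where
  open ≡-Reasoning
  zeroAt-suc : ∀ i → zeroAt x (f ∘ suc) i ≡ zeroAt (suc x) f (suc i)
  zeroAt-suc i with i ≟ x
  ... | yes _ = refl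
  ... | no  _ = refl

ΣFin≤sum-map : ∀ {n} (f : Fin n → ℕ) xs → (∀ u → 0 < f u → u ∈ xs) → ΣFin n f ≤ sum (map f xs)
ΣFin≤sum-map {n} f [] supp = ≤-reflexive (ΣFin-zero n f≡0)
  where
  f≡0 : ∀ u → f u ≡ 0
  f≡0 u with f u in eq
  ... | zero  = refl
  ... | suc _ with () ← supp u (subst (0 <_) (sym eq) z<s)
ΣFin≤sum-map {n} f (x ∷ xs) supp = begin
  ΣFin n f                       ≡⟨ ΣFin-split n x f ⟩
  f x + ΣFin n (zeroAt x f)      ≤⟨ +-monoʳ-≤ (f x) (ΣFin≤sum-map (zeroAt x f) xs supp′) ⟩
  f x + sum (map (zeroAt x f) xs) ≤⟨ +-monoʳ-≤ (f x) (sum-map-mono xs (zeroAt≤ x f)) ⟩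
  f x + sum (map f xs)           ∎
  where
  open ≤-Reasoning
  supp′ : ∀ u → 0 < zeroAt x f u → u ∈ xs
  supp′ u pos with u ≟ x
  ... | no u≢x with supp u pos
  ...   | here u≡x   = contradiction u≡x u≢x
  ...   | there u∈xs = u∈xs
  sum-map-mono : ∀ {g h : Fin n → ℕ} ys → (∀ u → g u ≤ h u) → sum (map g ys) ≤ sum (map h ys)
  sum-map-mono []       le = z≤n
  sum-map-mono (y ∷ ys) le = +-mono-≤ (le y) (sum-map-mono ys le)

iverson : Bool → ℕ
iverson true  = 1
iverson false = 0

iverson≤1 : ∀ b → iverson b ≤ 1
iverson≤1 true  = ≤-refl
iverson≤1 false = z≤n

count : ∀ k → (Fin k → Bool) → ℕ
count k P = ΣFin k (iverson ∘ P)

∣∣≡count-lookup : ∀ {n} (s : Subset n) → ∣ s ∣ ≡ count n (lookup s)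
∣∣≡count-lookup Vec.[]           = refl
∣∣≡count-lookup (true Vec.∷ s)  = cong suc (∣∣≡count-lookup s)
∣∣≡count-lookup (false Vec.∷ s) = ∣∣≡count-lookup s

count-pos⇒∃ : ∀ k (P : Fin k → Bool) → 0 < count k P → ∃ λ i → P i ≡ true
count-pos⇒∃ (suc k) P pos with P zero in eq
... | true  = zero , eq
... | false with i , Pi ← count-pos⇒∃ k (P ∘ suc) pos = suc i , Pi

count-none : ∀ k (P : Fin k → Bool) → (∀ i → P i ≢ true) → count k P ≡ 0
count-none k P none = ΣFin-zero k iverson≡0
  where
  iverson≡0 : ∀ i → iverson (P i) ≡ 0
  iverson≡0 i with P i in eq
  ... | true  = contradiction eq (none i)
  ... | false = refl

count-unique≤1 : ∀ k (P : Fin k → Bool) → (∀ i j → P i ≡ true → P j ≡ true → i ≡ j) →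
                 count k P ≤ 1
count-unique≤1 zero    P unique = z≤n
count-unique≤1 (suc k) P unique with P zero in eq
... | true  = ≤-reflexive (cong suc (count-none k (P ∘ suc) (λ i Pi → Fin.0≢1+n (unique zero (suc i) eq Pi))))
... | false = count-unique≤1 k (P ∘ suc) (λ i j Pi Pj → Fin.suc-injective (unique (suc i) (suc j) Pi Pj))

count-split : ∀ k (P Q : Fin k → Bool) →
              count k P ≡ count k (λ i → P i ∧ Q i) + count k (λ i → P i ∧ not (Q i))
count-split k P Q = trans (ΣFin-cong k split) (ΣFin-+ k _ _)
  where
  split : ∀ i → iverson (P i) ≡ iverson (P i ∧ Q i) + iverson (P i ∧ not (Q i))
  split i with P i | Q i
  ... | true  | true  = refl
  ... | true  | false = refl
  ... | false | _     = refl

count≤width : ∀ k (P : Fin k → Bool) (r : Fin k → ℕ) lo d →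
              (∀ i → P i ≡ true → lo ≤ r i × r i < lo + d) →
              (∀ i j → P i ≡ true → P j ≡ true → r i ≡ r j → i ≡ j) →
              count k P ≤ d
count≤width k P r lo zero range inj =
  ≤-reflexive (count-none k P (λ i Pi → <-irrefl refl (≤-<-trans (proj₁ (range i Pi))
                                                         (subst (r i <_) (+-identityʳ lo) (proj₂ (range i Pi))))))
count≤width k P r lo (suc d) range inj = begin
  count k P                            ≡⟨ count-split k P top ⟩
  count k (λ i → P i ∧ top i) + count k (λ i → P i ∧ not (top i))
                                       ≤⟨ +-mono-≤ (count-unique≤1 k _ unique-top)
                                                   (count≤width k _ r lo d range-rest inj-rest) ⟩
  1 + d                                ∎
  where
  open ≤-Reasoning
  top : Fin k → Bool
  top i = ⌊ r i ≟ℕ lo + d ⌋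
  unique-top : ∀ i j → P i ∧ top i ≡ true → P j ∧ top j ≡ true → i ≡ j
  unique-top i j ti tj with P i in Pi | r i ≟ℕ lo + d | P j in Pj | r j ≟ℕ lo + d
  ... | true | yes ri≡ | true | yes rj≡ = inj i j Pi Pj (trans ri≡ (sym rj≡))
  range-rest : ∀ i → P i ∧ not (top i) ≡ true → lo ≤ r i × r i < lo + d
  range-rest i ti with P i in Pi | r i ≟ℕ lo + d
  ... | true | no ri≢ = proj₁ (range i Pi) ,
                        ≤∧≢⇒< (≤-pred (subst (r i <_) (+-suc lo d) (proj₂ (range i Pi)))) ri≢
  inj-rest : ∀ i j → P i ∧ not (top i) ≡ true → P j ∧ not (top j) ≡ true → r i ≡ r j → i ≡ j
  inj-rest i j ti tj with P i in Pi | P j in Pj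
  ... | true | true = inj i j Pi Pj

lookup-⋃⁻ : ∀ {n} (ss : List (Subset n)) u → lookup (⋃ ss) u ≡ true →
            ∃ λ s → s ∈ ss × lookup s u ≡ true
lookup-⋃⁻ []       u eq rewrite Vecₚ.lookup-replicate u false with () ← eq
lookup-⋃⁻ (s ∷ ss) u eq rewrite Vecₚ.lookup-zipWith _∨_ u s (⋃ ss) with lookup s u in su
... | true  = s , here refl , su
... | false with t , t∈ss , tu ← lookup-⋃⁻ ss u eq = t , there t∈ss , tu

module _ {k : ℕ} (A : Fin (suc k) → Bool) (r : Fin (suc k) → ℕ) where

  -- Indices outside A get keys no index in A loses to, so the extremum lies in A once A is inhabited.
  private
    minKey : ℕ → Fin (suc k) → ℕ
    minKey top i = if A i then r i else top

    maxKey : Fin (suc k) → ℕ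
    maxKey i = if A i then suc (r i) else 0

    if-true : ∀ {b} {x y : ℕ} → b ≡ true → (if b then x else y) ≡ x
    if-true refl = refl

    if-false : ∀ {b} {x y : ℕ} → b ≡ false → (if b then x else y) ≡ y
    if-false refl = refl

  argminOn : ℕ → Fin (suc k)
  argminOn top = argmin (minKey top) zero (List.allFin _)

  argmaxOn : Fin (suc k)
  argmaxOn = argmax maxKey zero (List.allFin _)

  private
    minKey-≤ : ∀ top i → minKey top (argminOn top) ≤ minKey top i
    minKey-≤ top i = All.lookup (f[argmin]≤f[xs] {f = minKey top} zero (List.allFin _)) (∈-allFin i)

    maxKey-≥ : ∀ i → maxKey i ≤ maxKey argmaxOn
    maxKey-≥ i = All.lookup (f[xs]≤f[argmax] {f = maxKey} zero (List.allFin _)) (∈-allFin i)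

  argminOn-spec : ∀ top → (∀ i → r i < top) → ∀ {i} → A i ≡ true →
                  A (argminOn top) ≡ true × r (argminOn top) ≤ r i
  argminOn-spec top r<top {i} Ai = by-cases (A (argminOn top)) refl
    where
    by-cases : ∀ b → A (argminOn top) ≡ b → A (argminOn top) ≡ true × r (argminOn top) ≤ r i
    by-cases true  Am = Am , subst₂ _≤_ (if-true Am) (if-true Ai) (minKey-≤ top i)
    by-cases false Am = contradiction (subst₂ _≤_ (if-false Am) (if-true Ai) (minKey-≤ top i)) (<⇒≱ (r<top i))

  argmaxOn-spec : ∀ {i} → A i ≡ true → A argmaxOn ≡ true × r i ≤ r argmaxOn
  argmaxOn-spec {i} Ai = by-cases (A argmaxOn) refl
    where
    by-cases : ∀ b → A argmaxOn ≡ b → A argmaxOn ≡ true × r i ≤ r argmaxOn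
    by-cases true  Am = Am , s≤s⁻¹ (subst₂ _≤_ (if-true Ai) (if-true Am) (maxKey-≥ i))
    by-cases false Am = contradiction (subst₂ _≤_ (if-true Ai) (if-false Am) (maxKey-≥ i)) λ ()

-- Weighted positions around a cycle

≤-cancel-via : ∀ x y z {l r} → l ≤ r → x + z ≡ l → y + z ≡ r → x ≤ y
≤-cancel-via x y z l≤r refl refl = +-cancelʳ-≤ z x y l≤r

private
  open-span-arith : ∀ g lo hi t → g + lo ≤ 2 + hi → 2 * (0 + g) + lo + lo + 2 * t ≤ 2 * t + hi + hi + 4
  open-span-arith g lo hi t w = ≤-cancel-via _ _ 0 (+-mono-≤ (+-mono-≤ w w) (≤-refl {2 * t}))
    (solve (g ∷ lo ∷ t ∷ [])) (solve (hi ∷ t ∷ []))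

  extend-span-arith : ∀ S g f l t lof lol lot hif hil hit →
    2 * S + lof + lol + 2 * f ≤ 2 * l + hif + hil + 4 → g + lot ≤ 2 + hit →
    2 + hil + l ≤ t + lot → 2 + hit + l ≤ t + lol →
    2 * (S + g) + lof + lot + 2 * f ≤ 2 * t + hif + hit + 4
  extend-span-arith S g f l t lof lol lot hif hil hit I w a b =
    ≤-cancel-via _ _ (lol + lot + hil + hit + 2 * l + 4) (+-mono-≤ (+-mono-≤ I (+-mono-≤ w w)) (+-mono-≤ a b))
      (solve (S ∷ g ∷ f ∷ l ∷ t ∷ lof ∷ lol ∷ lot ∷ hif ∷ hil ∷ hit ∷ []))
      (solve (S ∷ g ∷ f ∷ l ∷ t ∷ lof ∷ lol ∷ lot ∷ hif ∷ hil ∷ hit ∷ []))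

  close-span-arith : ∀ S f l lof lol hif hil c →
    2 * S + lof + lol + 2 * f ≤ 2 * l + hif + hil + 4 →
    2 + hif + l ≤ c + f + lol → 2 + hil + l ≤ c + f + lof → S ≤ c
  close-span-arith S f l lof lol hif hil c I a b = *-cancelˡ-≤ 2
    (≤-cancel-via _ _ (lof + lol + 2 * f + 4 + hif + hil + 2 * l) (+-mono-≤ I (+-mono-≤ a b))
      (solve (S ∷ f ∷ l ∷ lof ∷ lol ∷ hif ∷ hil ∷ c ∷ []))
      (solve (S ∷ f ∷ l ∷ lof ∷ lol ∷ hif ∷ hil ∷ c ∷ [])))

module CyclicScan (c : ℕ) (g lo hi : ℕ → ℕ)
  (width : ∀ p → p < c → 0 < g p → g p + lo p ≤ 2 + hi p)
  (gap   : ∀ a b → a < b → b < c → 0 < g a → 0 < g b →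
           2 + hi a + a ≤ b + lo b × 2 + hi b + a ≤ b + lo a)
  (wrap  : ∀ a b → a ≤ b → b < c → 0 < g a → 0 < g b →
           2 + hi a + b ≤ c + a + lo b × 2 + hi b + b ≤ c + a + lo a)
  where

  -- 2 S ≤ 2 (l − f) + (hi f − lo f) + (hi l − lo l) + 4, with the subtractions moved across
  SpanBound : ℕ → ℕ → ℕ → Set
  SpanBound S f l = 2 * S + lo f + lo l + 2 * f ≤ 2 * l + hi f + hi l + 4

  data Scan (t : ℕ) : Set where
    empty : sumBelow t g ≡ 0 → Scan t
    span  : ∀ f l → f ≤ l → l < t → 0 < g f → 0 < g l → SpanBound (sumBelow t g) f l → Scan t

  private
    open-span : ∀ S t → S ≡ 0 → g t + lo t ≤ 2 + hi t → SpanBound (S + g t) t t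
    open-span S t refl w = open-span-arith (g t) (lo t) (hi t) t w

    extend-span : ∀ S f l t → SpanBound S f l → g t + lo t ≤ 2 + hi t →
                  2 + hi l + l ≤ t + lo t → 2 + hi t + l ≤ t + lo l → SpanBound (S + g t) f t
    extend-span S f l t = extend-span-arith S (g t) f l t (lo f) (lo l) (lo t) (hi f) (hi l) (hi t)

    close-span : ∀ S f l → SpanBound S f l →
                 2 + hi f + l ≤ c + f + lo l → 2 + hi l + l ≤ c + f + lo f → S ≤ c
    close-span S f l = close-span-arith S f l (lo f) (lo l) (hi f) (hi l) c

  scan : ∀ t → t ≤ c → Scan t
  scan zero    _   = empty refl
  scan (suc t) t<c with g t in eq | scan t (<⇒≤ t<c)
  ... | zero  | empty S≡0 = empty (trans (cong (sumBelow t g +_) eq) (trans (+-identityʳ _) S≡0))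
  ... | zero  | span f l f≤l l<t gf gl I =
    span f l f≤l (m≤n⇒m≤1+n l<t) gf gl
         (subst (λ S → SpanBound S f l) (sym (trans (cong (sumBelow t g +_) eq) (+-identityʳ _))) I)
  ... | suc _ | empty S≡0 =
    span t t ≤-refl ≤-refl gt gt (open-span (sumBelow t g) t S≡0 (width t t<c gt))
    where gt = subst (0 <_) (sym eq) z<s
  ... | suc _ | span f l f≤l l<t gf gl I =
    span f t (≤-trans f≤l (<⇒≤ l<t)) ≤-refl gf gt
         (extend-span (sumBelow t g) f l t I (width t t<c gt)
                      (proj₁ (gap l t l<t t<c gl gt)) (proj₂ (gap l t l<t t<c gl gt)))
    where gt = subst (0 <_) (sym eq) z<s

  sumBelow≤ : sumBelow c g ≤ c
  sumBelow≤ with scan c ≤-refl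
  ... | empty S≡0 = subst (_≤ c) (sym S≡0) z≤n
  ... | span f l f≤l l<c gf gl I =
    close-span (sumBelow c g) f l I (proj₁ (wrap f l f≤l l<c gf gl)) (proj₂ (wrap f l f≤l l<c gf gl))

module _ {A : Set} where

  open import Data.List.Relation.Unary.AllPairs using ([]; _∷_)
  open import Data.List.Relation.Unary.Linked using ([]; [-]; _∷_)

  Unique-++⁻ : ∀ xs {ys : List A} → Unique (xs ++ ys) → Unique xs × Unique ys × Disjoint xs ys
  Unique-++⁻ []       u          = [] , u , λ ()
  Unique-++⁻ (x ∷ xs) (x∉ ∷ u) with Unique-++⁻ xs u
  ... | uxs , uys , xs#ys = All.++⁻ˡ xs x∉ ∷ uxs , uys , x∷xs#ys
    where
    x∷xs#ys : Disjoint (x ∷ xs) _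
    x∷xs#ys (here refl , v∈ys) = All.lookup (All.++⁻ʳ xs x∉) v∈ys refl
    x∷xs#ys (there v∈xs , v∈ys) = xs#ys (v∈xs , v∈ys)

  module _ {R : A → A → Set} where

    Linked-++⁻ˡ : ∀ xs {ys} → Linked R (xs ++ ys) → Linked R xs
    Linked-++⁻ˡ []           _        = []
    Linked-++⁻ˡ (x ∷ [])     _        = [-]
    Linked-++⁻ˡ (x ∷ y ∷ xs) (r ∷ rs) = r ∷ Linked-++⁻ˡ (y ∷ xs) rs

    Linked-++⁻ʳ : ∀ xs {ys} → Linked R (xs ++ ys) → Linked R ys
    Linked-++⁻ʳ []           rs       = rs
    Linked-++⁻ʳ (x ∷ [])     {[]} _   = []
    Linked-++⁻ʳ (x ∷ [])     {y ∷ ys} (r ∷ rs) = rs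
    Linked-++⁻ʳ (x ∷ y ∷ xs) (r ∷ rs) = Linked-++⁻ʳ (y ∷ xs) rs

  subpath⊆ : ∀ xs (x : A) ys y zs → x ∷ ys ++ [ y ] ⊆ xs ++ x ∷ ys ++ y ∷ zs
  subpath⊆ xs x ys y zs =
    ⊆-trans (xs⊆xs++ys (x ∷ ys ++ [ y ]) zs)
            (⊆-trans (⊆-reflexive (cong (x ∷_) (++-assoc ys [ y ] zs))) (xs⊆ys++xs _ xs))

  tail⊆ : ∀ (xs : List A) → List.drop 1 xs ⊆ xs
  tail⊆ (x ∷ xs) = there

  split-nth : ∀ d (xs : List A) p → p < length xs →
              ∃₂ λ ys zs → xs ≡ ys ++ nth d xs p ∷ zs × length ys ≡ p
  split-nth d (x ∷ xs) zero    _        = [] , xs , refl , refl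
  split-nth d (x ∷ xs) (suc p) (s≤s p<) with split-nth d xs p p<
  ... | ys , zs , eq , len = x ∷ ys , zs , cong (x ∷_) eq , cong suc len

  ++∷-extends : ∀ (xs xs′ : List A) {x y ys ys′} → xs ++ x ∷ ys ≡ xs′ ++ y ∷ ys′ →
                length xs < length xs′ → ∃ λ zs → xs′ ≡ xs ++ x ∷ zs
  ++∷-extends []       (z ∷ zs) eq _ = zs , cong (_∷ zs) (sym (proj₁ (∷-injective eq)))
  ++∷-extends (a ∷ xs) (b ∷ xs′) eq (s≤s lt) with ∷-injective eq
  ... | refl , eq′ with ++∷-extends xs xs′ eq′ lt
  ... | zs , eq″ = zs , cong (a ∷_) eq″

  ++∷-same-position : ∀ (xs xs′ : List A) {x y ys ys′} → xs ++ x ∷ ys ≡ xs′ ++ y ∷ ys′ →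
                      length xs ≡ length xs′ → x ≡ y
  ++∷-same-position []       []        eq _   = proj₁ (∷-injective eq)
  ++∷-same-position (a ∷ xs) (b ∷ xs′) eq len =
    ++∷-same-position xs xs′ (proj₂ (∷-injective eq)) (suc-injective len)

  length-split₂ : ∀ xs (x : A) ys y zs →
                  length (xs ++ x ∷ ys ++ y ∷ zs) ≡ length xs + suc (length ys + suc (length zs))
  length-split₂ xs x ys y zs = trans (length-++ xs) (cong (λ l → length xs + suc l) (length-++ ys))

  split-nth₂ : ∀ d (xs : List A) {a b} → a < b → b < length xs →
               ∃₂ λ ys zs → ∃ λ ws → xs ≡ ys ++ nth d xs a ∷ zs ++ nth d xs b ∷ ws
                                   × length ys ≡ a × b ≡ a + suc (length zs)
  split-nth₂ d xs {a} {b} a<b b<len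
    with split-nth d xs a (<-trans a<b b<len) | split-nth d xs b b<len
  ... | ys , _ , eqa , refl | ys′ , ws , eqb , refl
    with ++∷-extends ys ys′ (trans (sym eqa) eqb) a<b
  ... | zs , refl = ys , zs , ws , eq , refl , length-++ ys
    where
    eq : xs ≡ ys ++ nth d xs (length ys) ∷ zs ++ nth d xs (length (ys ++ _ ∷ zs)) ∷ ws
    eq = trans eqb (++-assoc ys _ _)

-- Paths and cycles

module _ {n : ℕ} (G : Graph n) where

  open import Data.List.Relation.Unary.All using ([]; _∷_)
  open import Data.List.Relation.Unary.AllPairs using ([]; _∷_)
  open import Data.List.Relation.Unary.Linked using ([]; [-]; _∷_)

  private
    Path = IsPathBetween G
    Ad = Adj G
    last = lastOf G

  Adj-sym : ∀ {u v} → Ad u v → Ad v u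
  Adj-sym {u} {v} uv = trans (Graph.sym G v u) uv

  lastOf-++ : ∀ x xs y ys → last x (xs ++ y ∷ ys) ≡ last y ys
  lastOf-++ x []       y ys = refl
  lastOf-++ x (z ∷ xs) y ys = lastOf-++ z xs y ys

  lastOf-∈ : ∀ x xs → last x xs ∈ x ∷ xs
  lastOf-∈ x []       = here refl
  lastOf-∈ x (y ∷ xs) = there (lastOf-∈ y xs)

  Linked-join : ∀ x xs y ys → Linked Ad (x ∷ xs) → Ad (last x xs) y → Linked Ad (y ∷ ys) →
                Linked Ad (x ∷ xs ++ y ∷ ys)
  Linked-join x []       y ys _        xy rys = xy ∷ rys
  Linked-join x (z ∷ xs) y ys (r ∷ rs) zy rys = r ∷ Linked-join z xs y ys rs zy rys

  singleton-path : ∀ x → Path x x [ x ]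
  singleton-path x = refl , refl , [] ∷ [] , [-]

  path-start∈ : ∀ {a b} L → Path a b L → a ∈ L
  path-start∈ (x ∷ xs) (refl , _) = here refl

  path-end∈ : ∀ {a b} L → Path a b L → b ∈ L
  path-end∈ (x ∷ xs) (_ , refl , _) = lastOf-∈ x xs

  path-join : ∀ {a b c d} L M → Path a b L → Path c d M → Ad b c → Disjoint L M → Path a d (L ++ M)
  path-join (x ∷ xs) (y ∷ ys) (refl , refl , uL , rL) (refl , refl , uM , rM) bc L#M =
    refl , lastOf-++ x xs y ys , Unique-++⁺ uL uM L#M , Linked-join x xs y ys rL bc rM

  path-glue : ∀ {a b d} L M → Path a b L → Path b d M → Disjoint L (List.drop 1 M) → Path a d (L ++ List.drop 1 M)
  path-glue L (_ ∷ [])     pL (refl , refl , _) _ = subst (Path _ _) (sym (++-identityʳ L)) pL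
  path-glue L (_ ∷ y ∷ ys) pL (refl , refl , (_ ∷ uM) , (r ∷ rM)) L#M =
    path-join L (y ∷ ys) pL (refl , refl , uM , rM) r L#M

  path-start∉tail : ∀ {a b} L → Path a b L → a ∉ List.drop 1 L
  path-start∉tail (x ∷ xs) (refl , _ , u , _) = Unique[x∷xs]⇒x∉xs u

  path-nonempty : ∀ {a b} L → Path a b L → 1 ≤ length L
  path-nonempty (_ ∷ _) _ = s≤s z≤n

  path-reverse : ∀ {a b} L → Path a b L → Path b a (reverse L)
  path-reverse (x ∷ [])     (refl , refl , u , r) = refl , refl , u , r
  path-reverse (x ∷ y ∷ ys) (refl , refl , (x∉ ∷ u) , (xy ∷ r)) =
    subst (Path _ _) (sym (unfold-reverse x (y ∷ ys)))
      (path-join (reverse (y ∷ ys)) [ x ] (path-reverse (y ∷ ys) (refl , refl , u , r))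
                 (singleton-path x) (Adj-sym xy) x∉rev)
    where
    x∉rev : Disjoint (reverse (y ∷ ys)) [ x ]
    x∉rev (v∈ , here refl) = All.lookup x∉ (Any.reverse⁻ v∈) refl

  IsPath⇒Unique : ∀ {L} → IsPath G L → Unique L
  IsPath⇒Unique {_ ∷ _} (u , _) = u

  IsPath⇒Linked : ∀ {L} → IsPath G L → Linked Ad L
  IsPath⇒Linked {_ ∷ _} (_ , r) = r

  path⇒cycle : ∀ {a b} L → Path a b L → Ad b a → IsCycle G L
  path⇒cycle (x ∷ xs) (refl , refl , u , r) ba = u , r , λ _ → ba

  subpath : ∀ xs x ys y zs → let L = xs ++ x ∷ ys ++ y ∷ zs in
            Unique L → Linked Ad L → Path x y (x ∷ ys ++ [ y ])
  subpath xs x ys y zs u r =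
    refl , lastOf-++ x ys y [] , proj₁ (Unique-++⁻ (x ∷ ys ++ [ y ]) u′) , Linked-++⁻ˡ (x ∷ ys ++ [ y ]) r′
    where
    reassoc : xs ++ x ∷ ys ++ y ∷ zs ≡ xs ++ (x ∷ ys ++ [ y ]) ++ zs
    reassoc = cong (λ l → xs ++ x ∷ l) (sym (++-assoc ys [ y ] zs))
    u′ = proj₁ (proj₂ (Unique-++⁻ xs (subst Unique reassoc u)))
    r′ = Linked-++⁻ʳ xs (subst (Linked Ad) reassoc r)

  IsCycle⇒Unique : ∀ {C} → IsCycle G C → Unique C
  IsCycle⇒Unique {_ ∷ _} (u , _) = u

  IsCycle⇒Linked : ∀ {C} → IsCycle G C → Linked Ad C
  IsCycle⇒Linked {_ ∷ _} (_ , r , _) = r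

  cycle-closing : ∀ z zs y ys → IsCycle G (z ∷ zs ++ y ∷ ys) → Ad (last y ys) z
  cycle-closing z []       y []      (_ , (zy ∷ _) , _)  = Adj-sym zy
  cycle-closing z []       y (_ ∷ _) (_ , _ , closing) = closing (s≤s (s≤s z≤n))
  cycle-closing z (u ∷ zs) y ys      (_ , _ , closing) =
    subst (λ t → Ad t z) (lastOf-++ u zs y ys) (closing (s≤s 1≤length))
    where
    1≤length : 1 ≤ length (zs ++ y ∷ ys)
    1≤length = subst (1 ≤_) (sym (length-++ zs)) (≤-trans (s≤s z≤n) (m≤n+m (suc (length ys)) (length zs)))

  cycle-rotate : ∀ zs y ys → IsCycle G (zs ++ y ∷ ys) → Unique (y ∷ ys ++ zs) × Linked Ad (y ∷ ys ++ zs)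
  cycle-rotate []       y ys (u , r , _) = subst Unique (sym (++-identityʳ _)) u ,
                                           subst (Linked Ad) (sym (++-identityʳ _)) r
  cycle-rotate (z ∷ zs) y ys cyc@(u , r , _) with Unique-++⁻ (z ∷ zs) u
  ... | uzs , uys , zs#ys = Unique-++⁺ uys uzs (Disjoint.sym zs#ys) ,
                            Linked-join y ys z zs (Linked-++⁻ʳ (z ∷ zs) r) (cycle-closing z zs y ys cyc)
                                        (Linked-++⁻ˡ (z ∷ zs) r)

  module _ (C : List (Fin n)) (cycle : IsCycle G C) {xs x ys y zs} (split : C ≡ xs ++ x ∷ ys ++ y ∷ zs) where

    inner-arc : Path x y (x ∷ ys ++ [ y ]) × x ∷ ys ++ [ y ] ⊆ C
    inner-arc = subpath xs x ys y zs (subst Unique split (IsCycle⇒Unique cycle))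
                                     (subst (Linked Ad) split (IsCycle⇒Linked cycle)) ,
                subst (_ ⊆_) (sym split) (subpath⊆ xs x ys y zs)

    outer-arc : Path y x (y ∷ (zs ++ xs) ++ [ x ]) × y ∷ (zs ++ xs) ++ [ x ] ⊆ C
    outer-arc = subpath [] y (zs ++ xs) x ys (subst Unique reassoc u) (subst (Linked Ad) reassoc r) ,
                ⊆-trans (subpath⊆ [] y (zs ++ xs) x ys)
                        (⊆-reflexive-↭ (subst₂ _↭_ reassoc (sym split′) (++-comm (y ∷ zs) (xs ++ x ∷ ys))))
      where
      split′ : C ≡ (xs ++ x ∷ ys) ++ y ∷ zs
      split′ = trans split (sym (++-assoc xs (x ∷ ys) (y ∷ zs)))
      rotated = cycle-rotate (xs ++ x ∷ ys) y zs (subst (IsCycle G) split′ cycle)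
      u = proj₁ rotated
      r = proj₂ rotated
      reassoc : y ∷ zs ++ xs ++ x ∷ ys ≡ y ∷ (zs ++ xs) ++ x ∷ ys
      reassoc = cong (y ∷_) (sym (++-assoc zs xs (x ∷ ys)))


  longest-cycle-bound : ∀ C → (∀ D → IsCycle G D → length D ≤ length C) →
                        ∀ {x y a b} K T → Path y x K → K ⊆ C → Path a b T → All (_∉ C) T →
                        Ad x a → Ad b y → length K + length T ≤ length C
  longest-cycle-bound C longest K T pK K⊆C pT T∉C xa by =
    subst (_≤ length C) (length-++ K) (longest (K ++ T) (path⇒cycle (K ++ T) (path-join K T pK pT xa K#T) by))
    where
    K#T : Disjoint K T
    K#T (u∈K , u∈T) = All.lookup T∉C u∈T (K⊆C u∈K)

-- Bridges through Q

-- |x − y| < d, stated without truncated subtraction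
∣_-_∣<_ : ℕ → ℕ → ℕ → Set
∣ x - y ∣< d = x < d + y × y < d + x

∣-∣<-sym : ∀ {x y d} → ∣ x - y ∣< d → ∣ y - x ∣< d
∣-∣<-sym (x< , y<) = y< , x<

module Bridges {n : ℕ} (G : Graph n) (C Q : List (Fin n)) (Q-path : IsPath G Q) (Q∉C : All (_∉ C) Q)
  {q : ℕ} (v w : Fin (suc q) → Fin n) (P : Fin (suc q) → List (Fin n))
  (P-path : ∀ i → IsPathBetween G (v i) (w i) (P i))
  (P∉C : ∀ i → All (_∉ C) (P i))
  (P-disjoint : ∀ i j → i ≢ j → ∀ u → u ∈ P i → u ∉ P j)
  (v∈Q : ∀ i → v i ∈ Q)
  (P∩Q : ∀ i u → u ∈ P i → u ∈ Q → u ≡ v i)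
  where

  private
    Path = IsPathBetween G

  Q-split : ∀ i → ∃₂ λ ys zs → Q ≡ ys ++ v i ∷ zs
  Q-split i = ∈-∃++ (v∈Q i)

  position : Fin (suc q) → ℕ
  position i = length (proj₁ (Q-split i))

  position-injective : ∀ i j → position i ≡ position j → i ≡ j
  position-injective i j eq with i ≟ j
  ... | yes i≡j = i≡j
  ... | no  i≢j with Q-split i | Q-split j
  ... | ys , _ , Q≡i | ys′ , _ , Q≡j =
    contradiction (subst (_∈ P j) (sym vi≡vj) (path-start∈ G (P j) (P-path j)))
                  (P-disjoint i j i≢j (v i) (path-start∈ G (P i) (P-path i)))
    where
    vi≡vj = ++∷-same-position ys ys′ (trans (sym Q≡i) Q≡j) eq

  bridge-< : ∀ i j → position i < position j →
             ∃ λ T → Path (w i) (w j) T × All (_∉ C) T × position j < length T + position i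
  bridge-< i j pi<pj with Q-split i | Q-split j
  ... | ys , zs , Q≡i | ys′ , zs′ , Q≡j with ++∷-extends ys ys′ (trans (sym Q≡i) Q≡j) pi<pj
  ... | B , refl = T , T-path , T∉C , long
    where
    Q≡ : Q ≡ ys ++ v i ∷ B ++ v j ∷ zs′
    Q≡ = trans Q≡j (++-assoc ys (v i ∷ B) (v j ∷ zs′))
    segment : Path (v i) (v j) (v i ∷ B ++ [ v j ])
    segment = subpath G ys (v i) B (v j) zs′ (subst Unique Q≡ (IsPath⇒Unique G Q-path))
                                           (subst (Linked (Adj G)) Q≡ (IsPath⇒Linked G Q-path))
    B⊆Q : B ++ [ v j ] ⊆ Q
    B⊆Q = subst (_ ⊆_) (sym Q≡) (⊆-trans (xs⊆x∷xs _ (v i)) (subpath⊆ ys (v i) B (v j) zs′))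
    vi∉B : v i ∉ B ++ [ v j ]
    vi∉B = path-start∉tail G _ segment
    i≢j : i ≢ j
    i≢j refl = vi∉B (∈-++⁺ʳ B (here refl))
    T₁ = reverse (P i) ++ B ++ [ v j ]
    T₁-path : Path (w i) (v j) T₁
    T₁-path = path-glue G (reverse (P i)) _ (path-reverse G (P i) (P-path i)) segment Pi#B
      where
      Pi#B : Disjoint (reverse (P i)) (B ++ [ v j ])
      Pi#B {u} (u∈Pi , u∈B) = vi∉B (subst (_∈ _) (P∩Q i u (Any.reverse⁻ u∈Pi) (B⊆Q u∈B)) u∈B)
    T = T₁ ++ List.drop 1 (P j)
    T-path : Path (w i) (w j) T
    T-path = path-glue G T₁ (P j) T₁-path (P-path j) T₁#Pj
      where
      T₁#Pj : Disjoint T₁ (List.drop 1 (P j))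
      T₁#Pj {u} (u∈T₁ , u∈Pj) with ∈-++⁻ (reverse (P i)) u∈T₁
      ... | inj₁ u∈Pi = P-disjoint i j i≢j u (Any.reverse⁻ u∈Pi) (tail⊆ (P j) u∈Pj)
      ... | inj₂ u∈B  = path-start∉tail G (P j) (P-path j)
                          (subst (_∈ _) (P∩Q j u (tail⊆ (P j) u∈Pj) (B⊆Q u∈B)) u∈Pj)
    T∉C : All (_∉ C) T
    T∉C = All.++⁺ (All.++⁺ (All-resp-⊇ Any.reverse⁻ (P∉C i)) (All-resp-⊇ B⊆Q Q∉C))
                  (All.drop⁺ 1 (P∉C j))
    B<T : suc (length B) < length T
    B<T = begin-strict
      suc (length B)                                 <⟨ n<1+n _ ⟩
      1 + suc (length B)                             ≤⟨ +-monoˡ-≤ _ (path-nonempty G (P i) (P-path i)) ⟩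
      length (P i) + suc (length B)                  ≡⟨ cong₂ _+_ (sym (length-reverse (P i)))
                                                                   (trans (+-comm 1 _) (sym (length-++ B))) ⟩
      length (reverse (P i)) + length (B ++ [ v j ]) ≡⟨ length-++ (reverse (P i)) ⟨
      length T₁                                      ≤⟨ m≤m+n _ _ ⟩
      length T₁ + length (List.drop 1 (P j))         ≡⟨ length-++ T₁ ⟨
      length T                                       ∎
      where open ≤-Reasoning
    long : length (ys ++ v i ∷ B) < length T + length ys
    long = begin-strict
      length (ys ++ v i ∷ B)      ≡⟨ length-++ ys ⟩
      length ys + suc (length B)  ≡⟨ +-comm (length ys) _ ⟩
      suc (length B) + length ys  <⟨ +-monoˡ-< (length ys) B<T ⟩
      length T + length ys        ∎
      where open ≤-Reasoning

  bridge : ∀ i j → ∃ λ T → Path (w i) (w j) T × All (_∉ C) T × ∣ position i - position j ∣< length T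
  bridge i j with <-cmp (position i) (position j)
  ... | tri< pi<pj _ _ with T , T-path , T∉C , long ← bridge-< i j pi<pj =
    T , T-path , T∉C , <-≤-trans pi<pj (m≤n+m _ (length T)) , long
  ... | tri> _ _ pj<pi with T , T-path , T∉C , long ← bridge-< j i pj<pi =
    reverse T , path-reverse G T T-path , All-resp-⊇ Any.reverse⁻ T∉C ,
    subst (λ l → ∣ position i - position j ∣< l) (sym (length-reverse T))
          (∣-∣<-sym (<-≤-trans pj<pi (m≤n+m _ (length T)) , long))
  ... | tri≈ _ pi≡pj _ with refl ← position-injective i j pi≡pj =
    [ w i ] , singleton-path G (w i) ,
    All.tabulate (λ { (here refl) → All.lookup (P∉C i) (path-end∈ G (P i) (P-path i)) }) , n<1+n _ , n<1+n _

-- The longest cycle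

inner-gap-arith : ∀ x y k a b c → x + k < c + y → k + a ≡ suc b → 2 + x + b ≤ c + a + y
inner-gap-arith x y k a b c x+k< k+a≡ = begin
  2 + x + b          ≡⟨ solve (x ∷ b ∷ []) ⟩
  suc (x + suc b)    ≡⟨ cong (λ t → suc (x + t)) k+a≡ ⟨
  suc (x + (k + a))  ≡⟨ cong suc (+-assoc x k a) ⟨
  suc (x + k) + a    ≤⟨ +-monoˡ-≤ a x+k< ⟩
  c + y + a          ≡⟨ solve (c ∷ y ∷ a ∷ []) ⟩
  c + a + y          ∎
  where open ≤-Reasoning

outer-gap-arith : ∀ x y k a b c → x + k < c + y → k + b ≡ suc (c + a) → 2 + x + a ≤ b + y
outer-gap-arith x y k a b c x+k< k+b≡ = +-cancelʳ-≤ c _ _ (begin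
  2 + x + a + c          ≡⟨ solve (x ∷ a ∷ c ∷ []) ⟩
  suc (x + suc (c + a))  ≡⟨ cong (λ t → suc (x + t)) k+b≡ ⟨
  suc (x + (k + b))      ≡⟨ cong suc (+-assoc x k b) ⟨
  suc (x + k) + b        ≤⟨ +-monoˡ-≤ b x+k< ⟩
  c + y + b              ≡⟨ solve (c ∷ y ∷ b ∷ []) ⟩
  b + y + c              ∎)
  where open ≤-Reasoning

private
  inner-arc-length : ∀ z y → 1 + (z + 1 + y) ≡ 1 + (y + (1 + z))
  inner-arc-length = solve-∀

  outer-arc-length : ∀ w y z → 1 + (w + y + 1) + (y + (1 + z)) ≡ 1 + (y + (1 + (z + (1 + w))) + y)
  outer-arc-length = solve-∀

  width-arith : ∀ d l → d + 1 + l ≡ 1 + (l + d)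
  width-arith = solve-∀

module LongestCycle {n : ℕ} (G : Graph n) (C : List (Fin n))
  (cycle : IsCycle G C) (longest : ∀ D → IsCycle G D → length D ≤ length C)
  (Q : List (Fin n)) (Q-path : IsPath G Q) (Q∉C : All (_∉ C) Q)
  (q : ℕ) (v w : Fin (suc q) → Fin n) (P : Fin (suc q) → List (Fin n))
  (P-path : ∀ i → IsPathBetween G (v i) (w i) (P i))
  (P∉C : ∀ i → All (_∉ C) (P i))
  (P-disjoint : ∀ i j → i ≢ j → ∀ u → u ∈ P i → u ∉ P j)
  (v∈Q : ∀ i → v i ∈ Q)
  (P∩Q : ∀ i u → u ∈ P i → u ∈ Q → u ≡ v i)
  where

  open Bridges G C Q Q-path Q∉C v w P P-path P∉C P-disjoint v∈Q P∩Q
  open Graph G using (adj)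
  open import Data.List.Membership.DecPropositional (_≟_ {n}) using (_∈?_)

  private
    Path = IsPathBetween G
    c = length C

  arc-gap : ∀ {x y} K i j → Path y x K → K ⊆ C → Adj G (w i) x → Adj G (w j) y →
            position i + length K < c + position j × position j + length K < c + position i
  arc-gap K i j K-path K⊆C wi~x wj~y with T , T-path , T∉C , (pi< , pj<) ← bridge i j =
    shift pi< , shift pj<
    where
    K+T≤c : length K + length T ≤ c
    K+T≤c = longest-cycle-bound G C longest K T K-path K⊆C T-path T∉C (Adj-sym G wi~x) wj~y
    shift : ∀ {a b} → a < length T + b → a + length K < c + b
    shift {a} {b} a< = begin-strict
      a + length K             <⟨ +-monoˡ-< (length K) a< ⟩
      length T + b + length K  ≡⟨ trans (+-comm _ (length K)) (sym (+-assoc (length K) _ b)) ⟩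
      length K + length T + b  ≤⟨ +-monoˡ-≤ b K+T≤c ⟩
      c + b                    ∎
      where open ≤-Reasoning

  -- The default vertex of nth is never used: all positions are below length C.
  node : ℕ → Fin n
  node = nth (w zero) C

  node∈C : ∀ {p} → p < c → node p ∈ C
  node∈C {p} p<c with ys , zs , C≡ , _ ← split-nth (w zero) C p p<c =
    subst (_ ∈_) (sym C≡) (∈-++⁺ʳ ys (here refl))

  inner-arc-at : ∀ {a b} → a ≤ b → b < c →
                 ∃ λ K → Path (node a) (node b) K × K ⊆ C × length K + a ≡ suc b
  inner-arc-at {a} a≤b b<c with m≤n⇒m<n∨m≡n a≤b
  ... | inj₂ refl = [ node a ] , singleton-path G (node a) , (λ { (here refl) → node∈C b<c }) , refl
  ... | inj₁ a<b with ys , zs , ws , C≡ , refl , refl ← split-nth₂ (w zero) C a<b b<c =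
    _ , proj₁ arc , proj₂ arc , length-eq
    where
    arc = inner-arc G C cycle C≡
    length-eq : length (node (length ys) ∷ zs ++ [ _ ]) + length ys ≡ suc (length ys + suc (length zs))
    length-eq = trans (cong (λ l → suc (l + length ys)) (length-++ zs))
                      (inner-arc-length (length zs) (length ys))

  outer-arc-at : ∀ {a b} → a < b → b < c →
                 ∃ λ K → Path (node b) (node a) K × K ⊆ C × length K + b ≡ suc (c + a)
  outer-arc-at {a} a<b b<c with ys , zs , ws , C≡ , refl , refl ← split-nth₂ (w zero) C a<b b<c =
    _ , proj₁ arc , proj₂ arc , length-eq
    where
    arc = outer-arc G C cycle C≡
    length-eq : length (node (length ys + suc (length zs)) ∷ (ws ++ ys) ++ [ node (length ys) ])
                + (length ys + suc (length zs))
              ≡ suc (c + length ys)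
    length-eq = begin
      suc (length ((ws ++ ys) ++ [ node (length ys) ])) + (length ys + suc (length zs))
        ≡⟨ cong (λ l → suc l + (length ys + suc (length zs)))
                (trans (length-++ (ws ++ ys)) (cong (_+ 1) (length-++ ws))) ⟩
      suc (length ws + length ys + 1) + (length ys + suc (length zs))
        ≡⟨ outer-arc-length (length ws) (length ys) (length zs) ⟩
      suc (length ys + suc (length zs + suc (length ws)) + length ys)
        ≡⟨ cong (λ l → suc (l + length ys)) (trans (cong length C≡) (length-split₂ ys _ zs _ ws)) ⟨
      suc (c + length ys) ∎
      where open ≡-Reasoning

  inner-gap : ∀ {a b i j} → a ≤ b → b < c → Adj G (w i) (node a) → Adj G (w j) (node b) →
              2 + position i + b ≤ c + a + position j × 2 + position j + b ≤ c + a + position i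
  inner-gap {a} {b} a≤b b<c wi~a wj~b with K , K-path , K⊆C , len ← inner-arc-at a≤b b<c
    with j+K< , i+K< ← arc-gap K _ _ K-path K⊆C wj~b wi~a =
    inner-gap-arith _ _ (length K) a b c i+K< len , inner-gap-arith _ _ (length K) a b c j+K< len

  outer-gap : ∀ {a b i j} → a < b → b < c → Adj G (w i) (node a) → Adj G (w j) (node b) →
              2 + position i + a ≤ b + position j × 2 + position j + a ≤ b + position i
  outer-gap {a} {b} a<b b<c wi~a wj~b with K , K-path , K⊆C , len ← outer-arc-at a<b b<c
    with i+K< , j+K< ← arc-gap K _ _ K-path K⊆C wi~a wj~b =
    outer-gap-arith _ _ (length K) a b c i+K< len , outer-gap-arith _ _ (length K) a b c j+K< len

  Z : Fin (suc q) → Subset n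
  Z i = NC G C (w i)

  multiplicity : Fin n → ℕ
  multiplicity u = count (suc q) (λ i → lookup (Z i) u)

  weight : Fin n → ℕ
  weight u = multiplicity u + iverson (lookup (⋃Fin (suc q) Z) u)

  Σ∣Z∣+∣⋃Z∣≡Σweight : ΣFin (suc q) (λ i → ∣ Z i ∣) + ∣ ⋃Fin (suc q) Z ∣ ≡ ΣFin n weight
  Σ∣Z∣+∣⋃Z∣≡Σweight = trans (cong₂ _+_ Σ∣Z∣≡Σmultiplicity (∣∣≡count-lookup (⋃Fin (suc q) Z)))
                            (sym (ΣFin-+ n multiplicity (λ u → iverson (lookup (⋃Fin (suc q) Z) u))))
    where
    Σ∣Z∣≡Σmultiplicity : ΣFin (suc q) (λ i → ∣ Z i ∣) ≡ ΣFin n multiplicity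
    Σ∣Z∣≡Σmultiplicity = trans (ΣFin-cong (suc q) (λ i → ∣∣≡count-lookup (Z i)))
                               (ΣFin-swap (suc q) n (λ i u → iverson (lookup (Z i) u)))

  lookup-Z : ∀ i u → lookup (Z i) u ≡ adj (w i) u ∧ ⌊ u ∈? C ⌋
  lookup-Z i u = Vecₚ.lookup∘tabulate _ u

  ∈Z⁻ : ∀ {i u} → lookup (Z i) u ≡ true → u ∈ C × Adj G (w i) u
  ∈Z⁻ {i} {u} u∈Zi rewrite lookup-Z i u with adj (w i) u in wi~u | u ∈? C
  ... | true | yes u∈C = u∈C , refl

  Z-on-C : ∀ {u} → u ∈ C → ∀ i → lookup (Z i) u ≡ adj (w i) u
  Z-on-C {u} u∈C i rewrite lookup-Z i u with u ∈? C
  ... | yes _   = ∧-identityʳ _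
  ... | no u∉C = contradiction u∈C u∉C

  weighted⇒∈Z : ∀ {u} → 0 < weight u → ∃ λ i → lookup (Z i) u ≡ true
  weighted⇒∈Z {u} pos with lookup (⋃Fin (suc q) Z) u in u∈⋃Z
  ... | true with s , s∈Z , u∈s ← lookup-⋃⁻ (List.tabulate Z) u u∈⋃Z
             with i , refl ← ∈-tabulate⁻ {f = Z} s∈Z = i , u∈s
  ... | false = count-pos⇒∃ (suc q) _ (subst (0 <_) (+-identityʳ _) pos)

  position<length : ∀ i → position i < length Q
  position<length i with ys , zs , Q≡ ← Q-split i =
    subst (length ys <_) (sym (trans (cong length Q≡) (length-++ ys))) (m<m+n _ z<s)

  lowest highest : Fin n → Fin (suc q)
  lowest  u = argminOn (λ i → adj (w i) u) position (length Q)
  highest u = argmaxOn (λ i → adj (w i) u) position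

  lo hi : Fin n → ℕ
  lo u = position (lowest u)
  hi u = position (highest u)

  lowest-spec : ∀ {i u} → Adj G (w i) u → Adj G (w (lowest u)) u × lo u ≤ position i
  lowest-spec {u = u} = argminOn-spec (λ i → adj (w i) u) position (length Q) position<length

  highest-spec : ∀ {i u} → Adj G (w i) u → Adj G (w (highest u)) u × position i ≤ hi u
  highest-spec {u = u} = argmaxOn-spec (λ i → adj (w i) u) position

  lowest-adjacent : ∀ {u} → 0 < weight u → Adj G (w (lowest u)) u
  lowest-adjacent pos = proj₁ (lowest-spec (proj₂ (∈Z⁻ (proj₂ (weighted⇒∈Z pos)))))

  highest-adjacent : ∀ {u} → 0 < weight u → Adj G (w (highest u)) u
  highest-adjacent pos = proj₁ (highest-spec (proj₂ (∈Z⁻ (proj₂ (weighted⇒∈Z pos)))))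

  weight-width : ∀ {u} → u ∈ C → 0 < weight u → weight u + lo u ≤ 2 + hi u
  weight-width {u} u∈C pos = begin
    multiplicity u + iverson _ + lo u  ≤⟨ +-monoˡ-≤ (lo u) (+-mono-≤ multiplicity≤ (iverson≤1 _)) ⟩
    d + 1 + lo u                       ≡⟨ width-arith d (lo u) ⟩
    1 + (lo u + d)                     ≡⟨ cong suc (m+[n∸m]≡n lo≤1+hi) ⟩
    2 + hi u                           ∎
    where
    open ≤-Reasoning
    wi~u = proj₂ (∈Z⁻ (proj₂ (weighted⇒∈Z pos)))
    lo≤1+hi : lo u ≤ suc (hi u)
    lo≤1+hi = m≤n⇒m≤1+n (≤-trans (proj₂ (lowest-spec wi~u)) (proj₂ (highest-spec wi~u)))
    d = suc (hi u) ∸ lo u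
    multiplicity≤ : multiplicity u ≤ d
    multiplicity≤ = subst (_≤ d) (sym (ΣFin-cong (suc q) (λ i → cong iverson (Z-on-C u∈C i))))
      (count≤width (suc q) (λ i → adj (w i) u) position (lo u) d
        (λ i wi~u → proj₂ (lowest-spec wi~u) ,
                    subst (position i <_) (sym (m+[n∸m]≡n lo≤1+hi)) (s≤s (proj₂ (highest-spec wi~u))))
        (λ i j _ _ → position-injective i j))

  weighted⇒∈C : ∀ u → 0 < weight u → u ∈ C
  weighted⇒∈C u pos = proj₁ (∈Z⁻ (proj₂ (weighted⇒∈Z pos)))

  weight-along-C≤length : sumBelow c (weight ∘ node) ≤ c
  weight-along-C≤length = CyclicScan.sumBelow≤ c (weight ∘ node) (lo ∘ node) (hi ∘ node)
    (λ p p<c → weight-width (node∈C p<c))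
    (λ a b a<b b<c wa wb → proj₁ (outer-gap a<b b<c (highest-adjacent wa) (lowest-adjacent wb)) ,
                           proj₂ (outer-gap a<b b<c (lowest-adjacent wa) (highest-adjacent wb)))
    (λ a b a≤b b<c wa wb → proj₁ (inner-gap a≤b b<c (highest-adjacent wa) (lowest-adjacent wb)) ,
                           proj₂ (inner-gap a≤b b<c (lowest-adjacent wa) (highest-adjacent wb)))

lemma3 : {n : ℕ} (G : Graph n) (C : List (Fin n))
    → IsCycle G C
    → (∀ D → IsCycle G D → length D ≤ length C)
    → (Q : List (Fin n)) → IsPath G Q → All (_∉ C) Q
    → (q : ℕ) (v w : Fin (suc q) → Fin n) (P : Fin (suc q) → List (Fin n))
    → (∀ i → IsPathBetween G (v i) (w i) (P i))
    → (∀ i → All (_∉ C) (P i))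
    → (∀ i j → i ≢ j → ∀ u → u ∈ P i → u ∉ P j)
    → (∀ i → v i ∈ Q)
    → (∀ i u → u ∈ P i → u ∈ Q → u ≡ v i)
    → ΣFin (suc q) (λ i → ∣ NC G C (w i) ∣) + ∣ ⋃Fin (suc q) (λ i → NC G C (w i)) ∣ ≤ length C
lemma3 {n} G C cycle longest Q Q-path Q∉C q v w P P-path P∉C P-disjoint v∈Q P∩Q = begin
  ΣFin (suc q) (λ i → ∣ Z i ∣) + ∣ ⋃Fin (suc q) Z ∣  ≡⟨ Σ∣Z∣+∣⋃Z∣≡Σweight ⟩
  ΣFin n weight                                    ≤⟨ ΣFin≤sum-map weight C weighted⇒∈C ⟩
  sum (map weight C)                               ≡⟨ sum-map≡sumBelow-nth weight (w zero) C ⟩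
  sumBelow (length C) (weight ∘ node)              ≤⟨ weight-along-C≤length ⟩
  length C                                         ∎
  where
  open LongestCycle G C cycle longest Q Q-path Q∉C q v w P P-path P∉C P-disjoint v∈Q P∩Q
  open ≤-Reasoning
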